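{- Let $G=(X,E)$ be a symmetric 2-structure, $\mathcal{I}$ an involution of its colours without fixed point, and let $U,V$ be two crossing involution modules of $G$. Then $U\cup V$ is an involution module of $G$.
   Context: A (symmetric) 2-structure is a pair $G=(X,E)$ with $X$ finite and $E:X^2\to\mathbb{N}$ symmetric; its colour set is $C=\{E(u,v):u\neq v\}$. For $s\in X$, $i\in C$, $X'\subseteq X$, $N^i_s(X')=\{x\in X':E(s,x)=i\}$. Given an involution $\mathcal{I}$ of $C$ without fixed point, $U\subseteq X$ is an involution module if for all $u,v\in U$, either $N^i_u(X\setminus U)=N^{\mathcal{I}(i)}_v(X\setminus U)$ for all $i\in C$, or $N^i_u(X\setminus U)=N^{i}_v(X\setminus U)$ for all $i\in C$. Two sets $A,B\subseteq X$ are crossing if $A\cap B$, $A\setminus B$, $B\setminus A$ are all nonempty and $A\cup B\neq X$. -}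

module Defs where

open import Data.Nat using (ℕ)
open import Data.Fin using (Fin)
open import Data.Fin.Subset using (Subset; _∈_; _∉_; _∩_; _∪_; _─_; ⊤; Nonempty)
open import Data.Product using (Σ; _×_; _,_; ∃)
open import Data.Sum using (_⊎_)
open import Relation.Nullary using (¬_)
open import Relation.Binary.PropositionalEquality using (_≡_; _≢_)
open import Function.Bundles using (_⇔_)

record TwoStructure (n : ℕ) : Set where
  field
    E   : Fin n → Fin n → ℕ
    sym : ∀ u v → E u v ≡ E v u

open TwoStructure public

IsColour : {n : ℕ} → TwoStructure n → ℕ → Set
IsColour G i = Σ _ λ u → Σ _ λ v → (u ≢ v) × (E G u v ≡ i)

-- An involution of C without fixed point (represented by a function on ℕ
-- whose restriction to C is the involution).
record FPFInvolution {n : ℕ} (G : TwoStructure n) : Set where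
  field
    I        : ℕ → ℕ
    closed   : ∀ i → IsColour G i → IsColour G (I i)
    involut  : ∀ i → IsColour G i → I (I i) ≡ i
    noFixed  : ∀ i → IsColour G i → I i ≢ i

open FPFInvolution public

-- N^i_s(X') ⊆ X', described by membership: x ∈ N^i_s(X') ⇔ x ∈ X' ∧ E(s,x) = i.
-- Equality of neighbourhoods N^i_u(X∖U) = N^j_v(X∖U):
SameNbhd : {n : ℕ} → TwoStructure n → Subset n →
           Fin n → ℕ → Fin n → ℕ → Set
SameNbhd G U u i v j = ∀ x → x ∉ U → (E G u x ≡ i ⇔ E G v x ≡ j)

IsInvolutionModule : {n : ℕ} (G : TwoStructure n) → FPFInvolution G →
                     Subset n → Set
IsInvolutionModule G 𝓘 U =
  ∀ u v → u ∈ U → v ∈ U →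
    (∀ i → IsColour G i → SameNbhd G U u i v (I 𝓘 i))
    ⊎ (∀ i → IsColour G i → SameNbhd G U u i v i)

Crossing : {n : ℕ} → Subset n → Subset n → Set
Crossing A B = Nonempty (A ∩ B) × Nonempty (A ─ B) × Nonempty (B ─ A)
               × ¬ (A ∪ B ≡ ⊤)

-- Call u, v W-compatible when their colour-neighbourhoods outside W agree, either
-- directly or up to the involution. Compatibility is transitive, since the involution
-- composed with itself is the identity on colours, and it survives enlarging W. Two
-- vertices of U ∪ V lying in the same module are compatible for that module, hence for
-- U ∪ V; two vertices on different sides are linked through a vertex of U ∩ V, so of
-- crossing only the nonempty intersection is needed.
module Submission where

open import Defs
open import Data.Nat using (ℕ)
open import Data.Fin using (Fin)
open import Data.Fin.Subset using (Subset; _∈_; _∪_; _∩_; _⊆_; Nonempty)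
open import Data.Fin.Subset.Properties using (p⊆p∪q; q⊆p∪q; x∈p∪q⁻; x∈p∩q⁻)
open import Data.Product using (_,_; proj₁; proj₂)
open import Data.Sum using (_⊎_; inj₁; inj₂)
open import Function using (id; _∘_)
open import Function.Properties.Equivalence using () renaming (trans to ⇔-trans)
open import Relation.Binary.PropositionalEquality using (_≡_; subst)

module _ {n : ℕ} (G : TwoStructure n) (𝓘 : FPFInvolution G) where

  PreservesColours : (ℕ → ℕ) → Set
  PreservesColours f = ∀ i → IsColour G i → IsColour G (f i)

  SameNbhds : Subset n → Fin n → (ℕ → ℕ) → Fin n → Set
  SameNbhds W u f v = ∀ i → IsColour G i → SameNbhd G W u i v (f i)

  Compatible : Subset n → Fin n → Fin n → Set
  Compatible W u v = SameNbhds W u (I 𝓘) v ⊎ SameNbhds W u id v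

  sameNbhds-antimono : ∀ {W W′ u f v} → W ⊆ W′ →
                       SameNbhds W u f v → SameNbhds W′ u f v
  sameNbhds-antimono W⊆W′ same i c x x∉W′ = same i c x (x∉W′ ∘ W⊆W′)

  sameNbhds-∘ : ∀ {W u f w g v} → PreservesColours f →
                SameNbhds W u f w → SameNbhds W w g v → SameNbhds W u (g ∘ f) v
  sameNbhds-∘ f-colours uw wv i c x x∉W =
    ⇔-trans (uw i c x x∉W) (wv _ (f-colours i c) x x∉W)

  sameNbhds-cong : ∀ {W u f g v} → (∀ i → IsColour G i → f i ≡ g i) →
                   SameNbhds W u f v → SameNbhds W u g v
  sameNbhds-cong {W} {u} {v = v} f≗g same i c =
    subst (SameNbhd G W u i v) (f≗g i c) (same i c)

  compatible-antimono : ∀ {W W′ u v} → W ⊆ W′ →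
                        Compatible W u v → Compatible W′ u v
  compatible-antimono W⊆W′ (inj₁ same) = inj₁ (sameNbhds-antimono W⊆W′ same)
  compatible-antimono W⊆W′ (inj₂ same) = inj₂ (sameNbhds-antimono W⊆W′ same)

  compatible-trans : ∀ {W u w v} →
                     Compatible W u w → Compatible W w v → Compatible W u v
  compatible-trans (inj₁ uw) (inj₁ wv) =
    inj₂ (sameNbhds-cong (involut 𝓘) (sameNbhds-∘ (closed 𝓘) uw wv))
  compatible-trans (inj₁ uw) (inj₂ wv) = inj₁ (sameNbhds-∘ (closed 𝓘) uw wv)
  compatible-trans (inj₂ uw) (inj₁ wv) = inj₁ (sameNbhds-∘ (λ _ c → c) uw wv)
  compatible-trans (inj₂ uw) (inj₂ wv) = inj₂ (sameNbhds-∘ (λ _ c → c) uw wv)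

  module-compatible : ∀ {U W u v} → IsInvolutionModule G 𝓘 U → U ⊆ W →
                      u ∈ U → v ∈ U → Compatible W u v
  module-compatible U-module U⊆W u∈U v∈U =
    compatible-antimono U⊆W (U-module _ _ u∈U v∈U)

  ∪-isInvolutionModule : ∀ {U V} → Nonempty (U ∩ V) →
                         IsInvolutionModule G 𝓘 U → IsInvolutionModule G 𝓘 V →
                         IsInvolutionModule G 𝓘 (U ∪ V)
  ∪-isInvolutionModule {U} {V} (w , w∈U∩V) U-module V-module u v u∈ v∈ =
    compatible (x∈p∪q⁻ U V u∈) (x∈p∪q⁻ U V v∈)
    where
    inU : ∀ {x y} → x ∈ U → y ∈ U → Compatible (U ∪ V) x y
    inU = module-compatible U-module (p⊆p∪q V)

    inV : ∀ {x y} → x ∈ V → y ∈ V → Compatible (U ∪ V) x y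
    inV = module-compatible V-module (q⊆p∪q U V)

    w∈U : w ∈ U
    w∈U = proj₁ (x∈p∩q⁻ U V w∈U∩V)

    w∈V : w ∈ V
    w∈V = proj₂ (x∈p∩q⁻ U V w∈U∩V)

    compatible : u ∈ U ⊎ u ∈ V → v ∈ U ⊎ v ∈ V → Compatible (U ∪ V) u v
    compatible (inj₁ u∈U) (inj₁ v∈U) = inU u∈U v∈U
    compatible (inj₂ u∈V) (inj₂ v∈V) = inV u∈V v∈V
    compatible (inj₁ u∈U) (inj₂ v∈V) = compatible-trans (inU u∈U w∈U) (inV w∈V v∈V)
    compatible (inj₂ u∈V) (inj₁ v∈U) = compatible-trans (inV u∈V w∈V) (inU w∈U v∈U)

mainTheorem2 : {n : ℕ} (G : TwoStructure n) (𝓘 : FPFInvolution G)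
               (U V : Subset n) →
               IsInvolutionModule G 𝓘 U → IsInvolutionModule G 𝓘 V →
               Crossing U V → IsInvolutionModule G 𝓘 (U ∪ V)
mainTheorem2 G 𝓘 U V U-module V-module crossing =
  ∪-isInvolutionModule G 𝓘 (proj₁ crossing) U-module V-module
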